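{- Let $n=2k$ with $k>1$, let $\alpha$ be a primitive element of $\mathbb{F}_{3^n}$ and $I$ a primitive $4$th root of unity in $\mathbb{F}_{3^n}$. If $k$ is odd let $a_1=a_3=1$ and $a_2=\pm I$; if $k$ is even let $a_1=\alpha^{3^k+2}$, $a_3=\alpha$ and $a_2=\pm I a_1^{ -(3^k-3)/2}$ $(=\mp I a_3^{(3^k+5)/2})$, the sign being arbitrary. Then there exists a unique set $V$ of the form $V=\beta\,\mathbb{F}_{3^k}$ with $\beta\in\mathbb{F}_{3^n}^*$ such that $a_1c^{3^k-1}=a_2$ for every nonzero $c\in V$. Moreover, for such $c$, $$\operatorname{Tr}^n_k(a_1c^2)=\operatorname{Tr}^n_k(a_2c^4)=\operatorname{Tr}^n_k(a_3c^2)=0.$$ Also $V\cap\mathbb{F}_{3^k}=\{0\}$; when $k$ is even the orthogonal $V^{\perp}=\{y:\operatorname{Tr}_n(yv)=0\ \forall v\in V\}$ is supplementary to $V$, and when $k$ is odd $V$ is self-orthogonal ($\operatorname{Tr}_n(uv)=0$ for all $u,v\in V$).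
   Context: For $k\mid n$, $\operatorname{Tr}^n_k(x)=\sum_{i=0}^{n/k-1}x^{3^{ik}}$, and $\operatorname{Tr}_n=\operatorname{Tr}^n_1$. "Supplementary" means $V\oplus V^{\perp}=\mathbb{F}_{3^n}$. -}

module Defs where

open import Level using (0ℓ)
open import Data.Nat using (ℕ; zero; suc; _^_; _*_; _∸_; _/_; _<_)
open import Data.Fin using (Fin)
open import Data.Product using (Σ; _×_; ∃)
open import Data.Sum using (_⊎_)
open import Relation.Binary.PropositionalEquality using (_≡_; _≢_)
open import Algebra.Structures using (IsCommutativeRing)
open import Function.Definitions using (Injective; Surjective)

record FiniteField (q : ℕ) : Set₁ where
  infixl 6 _⊕_
  infixl 7 _·_
  field
    Carrier : Set
    _⊕_ _·_ : Carrier → Carrier → Carrier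
    -_ : Carrier → Carrier
    0# 1# : Carrier
    _⁻¹ : Carrier → Carrier
    isCommutativeRing : IsCommutativeRing _≡_ _⊕_ _·_ -_ 0# 1#
    0≢1 : 0# ≢ 1#
    inverse : ∀ x → x ≢ 0# → x · (x ⁻¹) ≡ 1#
    enum : Fin q → Carrier
    enum-injective : Injective _≡_ _≡_ enum
    enum-surjective : Surjective _≡_ _≡_ enum

module Ops {q : ℕ} (F : FiniteField q) where
  open FiniteField F

  pow : Carrier → ℕ → Carrier
  pow x zero = 1#
  pow x (suc m) = x · pow x m

  -- trace d k x = Σ_{i=0}^{d-1} x^{3^{i k}}; so Tr^n_k = trace (n/k) k, Tr_n = trace n 1
  trace : ℕ → ℕ → Carrier → Carrier
  trace zero k x = 0#
  trace (suc d) k x = trace d k x ⊕ pow x (3 ^ (d * k))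

  InSub : ℕ → Carrier → Set
  InSub k x = pow x (3 ^ k) ≡ x

  Primitive : Carrier → Set
  Primitive α = ∀ x → x ≢ 0# → ∃ λ i → pow α i ≡ x

  Primitive4thRoot : Carrier → Set
  Primitive4thRoot I = (pow I 4 ≡ 1#) × (pow I 2 ≢ 1#)

  InSpan : ℕ → Carrier → Carrier → Set
  InSpan k β x = Σ Carrier λ t → InSub k t × (x ≡ β · t)

  Good : ℕ → Carrier → Carrier → Carrier → Set
  Good k a₁ a₂ β = ∀ c → InSpan k β c → c ≢ 0# → a₁ · pow c (3 ^ k ∸ 1) ≡ a₂

  InPerp : ℕ → Carrier → Carrier → Set
  InPerp k β y = ∀ v → InSpan k β v → trace (2 * k) 1 (y · v) ≡ 0#

{-# OPTIONS --safe #-}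
-- Write Q = 3^k and P = Q - 1, so that F_{3^k} = {t | t^Q = t} and the unit group of F_{3^n} is
-- cyclic of order P(Q+1). Put T = a₂/a₁; the explicit coefficients satisfy T^{Q+1} = 1, so T = β^P
-- for some β, and c ↦ c^P takes the value T exactly on V∖{0} with V = β F_{3^k}. On V we have
-- c^Q = cT, hence Tr^n_k(a cᵉ) = (1 + a^P Tᵉ) a cᵉ, which vanishes since a^P Tᵉ = -1 for the three
-- pairs (a, e) (a mod-4 computation with 3^k ≡ 3 or 1), and V ∩ F_{3^k} = 0 because T ≠ 1.
-- Via Tr_n = Tr_k ∘ Tr^n_k, the trace form on V is (βs, βt) ↦ Tr_k(st β²(1 + T²)): identically
-- zero when T² = -1 (k odd), and otherwise nondegenerate, because Tr_n is not identically zero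
-- (Σⱼ Tr_n(αʲ) α⁻ʲ = -1 by geometric sums), which makes V ⊕ V⊥ the whole field.
module Submission where

open import Defs
open import Level using (0ℓ)
open import Data.Nat using (ℕ; zero; suc; _<_; _≤_; _^_; _*_; _∸_; _/_; _%_; _+_; s≤s; z≤n)
import Data.Nat.Properties as ℕ
open import Data.Nat.Tactic.RingSolver using (solve-∀)
open import Data.Product using (Σ; _×_; _,_; proj₁; proj₂; ∃)
open import Data.Sum using (_⊎_; inj₁; inj₂)
open import Data.Fin as Fin using (Fin; toℕ; fromℕ<; punchIn; punchOut)
open import Data.Fin.Properties using (¬Fin0; ¬∀⟶∃¬; toℕ<n; toℕ-fromℕ<; toℕ-fromℕ; toℕ-inject₁; punchIn-injective; punchInᵢ≢i; punchOut-injective; pigeonhole; injective⇒≤)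
open import Data.Nat.DivMod using (m≡m%n+[m/n]*n; m%n<n; m*n/n≡m)
open import Data.Nat.Divisibility using (_∣_; divides; m%n≡0⇒n∣m; ∣⇒≤)
open import Data.Empty using (⊥; ⊥-elim)
open import Function using (_∘_)
open import Relation.Nullary using (Dec; yes; no; ¬_)
open import Relation.Binary.PropositionalEquality using (_≡_; _≢_; refl; sym; trans; cong; cong₂; subst; subst₂; module ≡-Reasoning)
open import Algebra.Bundles using (CommutativeRing)

module FieldProperties {q : ℕ} (F : FiniteField q) where
  open FiniteField F
  open Ops F
  open ≡-Reasoning

  commutativeRing : CommutativeRing 0ℓ 0ℓ
  commutativeRing = record { isCommutativeRing = isCommutativeRing }

  open CommutativeRing commutativeRing public
    using ( +-assoc; +-comm; +-identityˡ; +-identityʳ; -‿inverseˡ; -‿inverseʳ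
          ; *-assoc; *-comm; *-identityˡ; *-identityʳ; distribˡ; distribʳ; zeroˡ; zeroʳ
          ; semiring; commutativeSemiring; ring; +-group; +-commutativeSemigroup; *-commutativeSemigroup)
  open import Algebra.Properties.Ring ring public using (-1*x≈-x; -‿involutive)
  open import Algebra.Properties.CommutativeSemigroup +-commutativeSemigroup public using () renaming (interchange to +-interchange)
  open import Algebra.Properties.CommutativeSemigroup *-commutativeSemigroup public using () renaming (interchange to *-interchange)
  open import Algebra.Properties.Group +-group public using (ε⁻¹≈ε; inverseˡ-unique; inverseʳ-unique; identityˡ-unique; identityʳ-unique)
  open import Algebra.Properties.Semiring.Exp semiring using (^-homo-*; ^-assocʳ) renaming (_^_ to _^ᶠ_)
  open import Algebra.Properties.CommutativeSemiring.Exp commutativeSemiring using (^-distrib-*)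
  open import Algebra.Solver.Ring.NaturalCoefficients.Default commutativeSemiring public

  index : Carrier → Fin q
  index x = proj₁ (enum-surjective x)

  enum-index : ∀ x → enum (index x) ≡ x
  enum-index x = proj₂ (enum-surjective x) refl

  index-enum : ∀ i → index (enum i) ≡ i
  index-enum i = enum-injective (enum-index (enum i))

  _≟_ : (x y : Carrier) → Dec (x ≡ y)
  x ≟ y with index x Fin.≟ index y
  ... | yes i≡j = yes (trans (sym (enum-index x)) (trans (cong enum i≡j) (enum-index y)))
  ... | no i≢j = no λ x≡y → i≢j (cong index x≡y)

  pow≡^ : ∀ x n → pow x n ≡ x ^ᶠ n
  pow≡^ x zero = refl
  pow≡^ x (suc n) = cong (x ·_) (pow≡^ x n)

  pow-+ : ∀ x m n → pow x (m + n) ≡ pow x m · pow x n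
  pow-+ x m n rewrite pow≡^ x (m + n) | pow≡^ x m | pow≡^ x n = ^-homo-* x m n

  pow-* : ∀ x m n → pow x (m * n) ≡ pow (pow x m) n
  pow-* x m n rewrite pow≡^ x (m * n) | pow≡^ x m | pow≡^ (x ^ᶠ m) n = sym (^-assocʳ x m n)

  pow-· : ∀ x y n → pow (x · y) n ≡ pow x n · pow y n
  pow-· x y n rewrite pow≡^ (x · y) n | pow≡^ x n | pow≡^ y n = ^-distrib-* x y n

  pow-*-comm : ∀ x m n → pow (pow x m) n ≡ pow (pow x n) m
  pow-*-comm x m n = trans (sym (pow-* x m n)) (trans (cong (pow x) (ℕ.*-comm m n)) (pow-* x n m))

  pow-1# : ∀ n → pow 1# n ≡ 1#
  pow-1# zero = refl
  pow-1# (suc n) = trans (*-identityˡ _) (pow-1# n)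

  pow-0# : ∀ n → pow 0# (suc n) ≡ 0#
  pow-0# n = zeroˡ _

  pow-1 : ∀ x → pow x 1 ≡ x
  pow-1 = *-identityʳ

  1≢0 : 1# ≢ 0#
  1≢0 1≡0 = 0≢1 (sym 1≡0)

  inverseˡ : ∀ x → x ≢ 0# → x ⁻¹ · x ≡ 1#
  inverseˡ x x≢0 = trans (*-comm _ _) (inverse x x≢0)

  ·-cancelˡ : ∀ {x y z} → x ≢ 0# → x · y ≡ x · z → y ≡ z
  ·-cancelˡ {x} {y} {z} x≢0 xy≡xz = begin
    y                ≡⟨ sym (*-identityˡ y) ⟩
    1# · y           ≡⟨ cong (_· y) (sym (inverseˡ x x≢0)) ⟩
    (x ⁻¹ · x) · y   ≡⟨ *-assoc _ _ _ ⟩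
    x ⁻¹ · (x · y)   ≡⟨ cong (x ⁻¹ ·_) xy≡xz ⟩
    x ⁻¹ · (x · z)   ≡⟨ sym (*-assoc _ _ _) ⟩
    (x ⁻¹ · x) · z   ≡⟨ cong (_· z) (inverseˡ x x≢0) ⟩
    1# · z           ≡⟨ *-identityˡ z ⟩
    z                ∎

  ·-cancelʳ : ∀ {x y z} → x ≢ 0# → y · x ≡ z · x → y ≡ z
  ·-cancelʳ {x} {y} {z} x≢0 yx≡zx = ·-cancelˡ x≢0 (trans (*-comm x y) (trans yx≡zx (*-comm z x)))

  ·-cancelˡ-1 : ∀ {x y} → x ≢ 0# → x · y ≡ x → y ≡ 1#
  ·-cancelˡ-1 x≢0 xy≡x = ·-cancelˡ x≢0 (trans xy≡x (sym (*-identityʳ _)))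

  zero-product : ∀ x y → x · y ≡ 0# → x ≡ 0# ⊎ y ≡ 0#
  zero-product x y xy≡0 with x ≟ 0#
  ... | yes x≡0 = inj₁ x≡0
  ... | no x≢0 = inj₂ (·-cancelˡ x≢0 (trans xy≡0 (sym (zeroʳ x))))

  ·-≢0 : ∀ {x y} → x ≢ 0# → y ≢ 0# → x · y ≢ 0#
  ·-≢0 {x} {y} x≢0 y≢0 xy≡0 with zero-product x y xy≡0
  ... | inj₁ x≡0 = x≢0 x≡0
  ... | inj₂ y≡0 = y≢0 y≡0

  pow-≢0 : ∀ {x} n → x ≢ 0# → pow x n ≢ 0#
  pow-≢0 zero x≢0 = 1≢0
  pow-≢0 (suc n) x≢0 = ·-≢0 x≢0 (pow-≢0 n x≢0)

  pow≡0⇒≡0 : ∀ {x} n → pow x n ≡ 0# → x ≡ 0#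
  pow≡0⇒≡0 {x} n xⁿ≡0 with x ≟ 0#
  ... | yes x≡0 = x≡0
  ... | no x≢0 = ⊥-elim (pow-≢0 n x≢0 xⁿ≡0)

  ⁻¹-≢0 : ∀ {x} → x ≢ 0# → x ⁻¹ ≢ 0#
  ⁻¹-≢0 {x} x≢0 x⁻¹≡0 = 0≢1 (trans (sym (zeroʳ x)) (trans (cong (x ·_) (sym x⁻¹≡0)) (inverse x x≢0)))

  ⁻¹-unique : ∀ {x y} → x ≢ 0# → y · x ≡ 1# → y ≡ x ⁻¹
  ⁻¹-unique {x} x≢0 yx≡1 = ·-cancelʳ x≢0 (trans yx≡1 (sym (inverseˡ x x≢0)))

  pow-⁻¹ : ∀ {x} n → x ≢ 0# → pow (x ⁻¹) n · pow x n ≡ 1#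
  pow-⁻¹ {x} n x≢0 = trans (sym (pow-· (x ⁻¹) x n)) (trans (cong (λ z → pow z n) (inverseˡ x x≢0)) (pow-1# n))

  x≡v+[x-v] : ∀ x v → x ≡ v ⊕ (x ⊕ - v)
  x≡v+[x-v] x v = sym (trans (+-comm v _) (trans (+-assoc x (- v) v) (trans (cong (x ⊕_) (-‿inverseˡ v)) (+-identityʳ x))))

  x-1≡0⇒x≡1 : ∀ {x} → x ⊕ - 1# ≡ 0# → x ≡ 1#
  x-1≡0⇒x≡1 {x} x-1≡0 = trans (inverseˡ-unique x (- 1#) x-1≡0) (-‿involutive 1#)

  -1≢0 : - 1# ≢ 0#
  -1≢0 -1≡0 = 1≢0 (trans (sym (-‿involutive 1#)) (trans (cong -_ -1≡0) ε⁻¹≈ε))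

  -1·-1≡1 : - 1# · - 1# ≡ 1#
  -1·-1≡1 = trans (-1*x≈-x (- 1#)) (-‿involutive 1#)

  pow-2 : ∀ x → pow x 2 ≡ x · x
  pow-2 x = cong (x ·_) (pow-1 x)

  pow-−1-even : ∀ n → pow (- 1#) (2 * n) ≡ 1#
  pow-−1-even n = trans (pow-* (- 1#) 2 n) (trans (cong (λ z → pow z n) (trans (pow-2 _) -1·-1≡1)) (pow-1# n))

  pow-−1-odd : ∀ n → pow (- 1#) (suc (2 * n)) ≡ - 1#
  pow-−1-odd n = trans (cong (- 1# ·_) (pow-−1-even n)) (*-identityʳ _)

  x²≡1⇒x≡±1 : ∀ x → x · x ≡ 1# → x ≡ 1# ⊎ x ≡ - 1#
  x²≡1⇒x≡±1 x x²≡1 with zero-product (x ⊕ - 1#) (x ⊕ 1#) factorisation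
    where
    factorisation : (x ⊕ - 1#) · (x ⊕ 1#) ≡ 0#
    factorisation = begin
      (x ⊕ - 1#) · (x ⊕ 1#)                  ≡⟨ solve 2 (λ x m → (x :+ m) :* (x :+ con 1) := (x :* x :+ m) :+ (x :+ m :* x)) refl x (- 1#) ⟩
      (x · x ⊕ - 1#) ⊕ (x ⊕ - 1# · x)        ≡⟨ cong₂ (λ a b → (a ⊕ - 1#) ⊕ (x ⊕ b)) x²≡1 (-1*x≈-x x) ⟩
      (1# ⊕ - 1#) ⊕ (x ⊕ - x)                ≡⟨ cong₂ _⊕_ (-‿inverseʳ 1#) (-‿inverseʳ x) ⟩
      0# ⊕ 0#                                ≡⟨ +-identityˡ 0# ⟩
      0#                                     ∎
  ... | inj₁ x-1≡0 = inj₁ (x-1≡0⇒x≡1 x-1≡0)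
  ... | inj₂ x+1≡0 = inj₂ (inverseˡ-unique x 1# x+1≡0)

module Characteristic {q : ℕ} (F : FiniteField q) where
  open FiniteField F
  open Ops F
  open FieldProperties F
  open import Algebra.Properties.Semiring.Sum semiring using (sum; sum-permute; sum-cong-≋; ∑-distrib-+; sum-replicate)
  import Algebra.Properties.Semiring.Mult semiring as Mult
  open import Data.Fin.Permutation using (Permutation; permutation)
  open ≡-Reasoning

  ι : ℕ → Carrier
  ι n = n Mult.× 1#

  ι-^ : ∀ a n → ι (a ^ n) ≡ pow (ι a) n
  ι-^ a zero = +-identityʳ 1#
  ι-^ a (suc n) = trans (Mult.×1-homo-* a (a ^ n)) (cong (ι a ·_) (ι-^ a n))

  +1-permutation : Permutation q q
  +1-permutation = permutation (λ i → index (enum i ⊕ 1#)) (λ i → index (enum i ⊕ - 1#))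
    (shift-back (- 1#) 1# (-‿inverseˡ 1#)) (shift-back 1# (- 1#) (-‿inverseʳ 1#))
    where
    shift-back : ∀ a b → a ⊕ b ≡ 0# → ∀ i → index (enum (index (enum i ⊕ a)) ⊕ b) ≡ i
    shift-back a b a+b≡0 i = begin
      index (enum (index (enum i ⊕ a)) ⊕ b) ≡⟨ cong (λ z → index (z ⊕ b)) (enum-index _) ⟩
      index ((enum i ⊕ a) ⊕ b)              ≡⟨ cong index (+-assoc _ _ _) ⟩
      index (enum i ⊕ (a ⊕ b))              ≡⟨ cong (λ z → index (enum i ⊕ z)) a+b≡0 ⟩
      index (enum i ⊕ 0#)                   ≡⟨ cong index (+-identityʳ _) ⟩
      index (enum i)                        ≡⟨ index-enum i ⟩
      i                                     ∎

  -- Translating every element by 1 permutes the field, so the sum of all elements absorbs q · 1.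
  ι-q≡0 : ι q ≡ 0#
  ι-q≡0 = identityʳ-unique (sum enum) (ι q) (sym (begin
    sum enum                               ≡⟨ sum-permute enum +1-permutation ⟩
    sum (λ i → enum (index (enum i ⊕ 1#))) ≡⟨ sum-cong-≋ {q} {λ i → enum (index (enum i ⊕ 1#))} (λ i → enum-index _) ⟩
    sum (λ i → enum i ⊕ 1#)                ≡⟨ ∑-distrib-+ enum (λ _ → 1#) ⟩
    sum enum ⊕ sum {q} (λ _ → 1#)          ≡⟨ cong (sum enum ⊕_) (sum-replicate q) ⟩
    sum enum ⊕ ι q                         ∎))

  characteristic-3 : ∀ m → q ≡ 3 ^ m → ι 3 ≡ 0#
  characteristic-3 m refl = pow≡0⇒≡0 m (trans (sym (ι-^ 3 m)) ι-q≡0)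

  module _ (ι3≡0 : ι 3 ≡ 0#) where
    -1≢1 : - 1# ≢ 1#
    -1≢1 -1≡1 = 1≢0 (begin
      1#                          ≡⟨ sym (+-identityʳ 1#) ⟩
      1# ⊕ 0#                     ≡⟨ cong (1# ⊕_) (sym (-‿inverseˡ 1#)) ⟩
      1# ⊕ (- 1# ⊕ 1#)            ≡⟨ cong (λ z → 1# ⊕ (z ⊕ 1#)) -1≡1 ⟩
      1# ⊕ (1# ⊕ 1#)              ≡⟨ cong (λ z → 1# ⊕ (1# ⊕ z)) (sym (+-identityʳ 1#)) ⟩
      1# ⊕ (1# ⊕ (1# ⊕ 0#))       ≡⟨ ι3≡0 ⟩
      0#                          ∎)

    cube-+ : ∀ x y → pow (x ⊕ y) 3 ≡ pow x 3 ⊕ pow y 3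
    cube-+ x y = begin
      pow (x ⊕ y) 3
        ≡⟨ solve 2 (λ x y → (x :+ y) :* ((x :+ y) :* ((x :+ y) :* con 1)) :=
                            (x :* (x :* (x :* con 1)) :+ y :* (y :* (y :* con 1)))
                            :+ (con 1 :+ (con 1 :+ (con 1 :+ con 0))) :* (x :* x :* y :+ x :* y :* y)) refl x y ⟩
      (pow x 3 ⊕ pow y 3) ⊕ ι 3 · (x · x · y ⊕ x · y · y)
        ≡⟨ cong (λ c → (pow x 3 ⊕ pow y 3) ⊕ c · (x · x · y ⊕ x · y · y)) ι3≡0 ⟩
      (pow x 3 ⊕ pow y 3) ⊕ 0# · (x · x · y ⊕ x · y · y)
        ≡⟨ trans (cong (pow x 3 ⊕ pow y 3 ⊕_) (zeroˡ _)) (+-identityʳ _) ⟩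
      pow x 3 ⊕ pow y 3 ∎

    frobenius : ∀ j x y → pow (x ⊕ y) (3 ^ j) ≡ pow x (3 ^ j) ⊕ pow y (3 ^ j)
    frobenius zero x y = trans (pow-1 _) (sym (cong₂ _⊕_ (pow-1 x) (pow-1 y)))
    frobenius (suc j) x y = begin
      pow (x ⊕ y) (3 * 3 ^ j)                       ≡⟨ pow-* (x ⊕ y) 3 (3 ^ j) ⟩
      pow (pow (x ⊕ y) 3) (3 ^ j)                   ≡⟨ cong (λ z → pow z (3 ^ j)) (cube-+ x y) ⟩
      pow (pow x 3 ⊕ pow y 3) (3 ^ j)               ≡⟨ frobenius j _ _ ⟩
      pow (pow x 3) (3 ^ j) ⊕ pow (pow y 3) (3 ^ j) ≡⟨ sym (cong₂ _⊕_ (pow-* x 3 (3 ^ j)) (pow-* y 3 (3 ^ j))) ⟩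
      pow x (3 * 3 ^ j) ⊕ pow y (3 * 3 ^ j)         ∎

    trace-+ : ∀ d j x y → trace d j (x ⊕ y) ≡ trace d j x ⊕ trace d j y
    trace-+ zero j x y = sym (+-identityˡ 0#)
    trace-+ (suc d) j x y = trans (cong₂ _⊕_ (trace-+ d j x y) (frobenius (d * j) x y)) (+-interchange _ _ _ _)

module TraceProperties {q : ℕ} (F : FiniteField q) where
  open FiniteField F
  open Ops F
  open FieldProperties F
  open import Algebra.Properties.Semiring.Sum semiring using (sum; sum-syntax; sum-cong-≋; sum-init-last)
  open ≡-Reasoning

  trace-0# : ∀ d j → trace d j 0# ≡ 0#
  trace-0# zero j = refl
  trace-0# (suc d) j = trans (cong₂ _⊕_ (trace-0# d j) (pow≡0 (3 ^ (d * j)) (ℕ.m^n>0 3 (d * j)))) (+-identityˡ 0#)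
    where
    pow≡0 : ∀ e → 0 < e → pow 0# e ≡ 0#
    pow≡0 (suc e) _ = pow-0# e

  trace-split : ∀ b a j z → trace (b + a) j z ≡ trace a j z ⊕ trace b j (pow z (3 ^ (a * j)))
  trace-split zero a j z = sym (+-identityʳ _)
  trace-split (suc b) a j z = trans (cong₂ _⊕_ (trace-split b a j z) last-term) (+-assoc _ _ _)
    where
    last-term : pow z (3 ^ ((b + a) * j)) ≡ pow (pow z (3 ^ (a * j))) (3 ^ (b * j))
    last-term = begin
      pow z (3 ^ ((b + a) * j))               ≡⟨ cong (λ e → pow z (3 ^ e)) (trans (ℕ.*-distribʳ-+ j b a) (ℕ.+-comm (b * j) (a * j))) ⟩
      pow z (3 ^ (a * j + b * j))             ≡⟨ cong (pow z) (ℕ.^-distribˡ-+-* 3 (a * j) (b * j)) ⟩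
      pow z (3 ^ (a * j) * 3 ^ (b * j))       ≡⟨ pow-* z (3 ^ (a * j)) (3 ^ (b * j)) ⟩
      pow (pow z (3 ^ (a * j))) (3 ^ (b * j)) ∎

  trace≡∑ : ∀ d j x → trace d j x ≡ ∑[ i < d ] pow x (3 ^ (toℕ i * j))
  trace≡∑ zero j x = refl
  trace≡∑ (suc d) j x = begin
    trace d j x ⊕ term d
      ≡⟨ cong₂ _⊕_ (trans (trace≡∑ d j x) (sum-cong-≋ {d} {λ i → term (toℕ i)} {λ i → term (toℕ (Fin.inject₁ i))}
                                             (λ i → cong term (sym (toℕ-inject₁ i)))))
                   (cong term (sym (toℕ-fromℕ d))) ⟩
    sum {d} (λ i → term (toℕ (Fin.inject₁ i))) ⊕ term (toℕ (Fin.fromℕ d))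
      ≡⟨ sym (sum-init-last {d} (λ i → term (toℕ i))) ⟩
    ∑[ i < suc d ] term (toℕ i) ∎
    where
    term : ℕ → Carrier
    term i = pow x (3 ^ (i * j))

module Cyclic {N : ℕ} (F : FiniteField (suc N)) {α : FiniteField.Carrier F}
               (α-primitive : Ops.Primitive F α) (α≢0 : α ≢ FiniteField.0# F) where
  open FiniteField F
  open Ops F
  open FieldProperties F
  open ≡-Reasoning

  pow-α-≢0 : ∀ i → pow α i ≢ 0#
  pow-α-≢0 i = pow-≢0 i α≢0

  pow-α-% : ∀ d → pow α (suc d) ≡ 1# → ∀ i → pow α (i % suc d) ≡ pow α i
  pow-α-% d αᵈ≡1 i = sym (begin
    pow α i                                        ≡⟨ cong (pow α) (m≡m%n+[m/n]*n i (suc d)) ⟩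
    pow α (i % suc d + i / suc d * suc d)          ≡⟨ pow-+ α (i % suc d) _ ⟩
    pow α (i % suc d) · pow α (i / suc d * suc d)  ≡⟨ cong (pow α (i % suc d) ·_) (pow-multiple (i / suc d)) ⟩
    pow α (i % suc d) · 1#                         ≡⟨ *-identityʳ _ ⟩
    pow α (i % suc d)                              ∎)
    where
    pow-multiple : ∀ m → pow α (m * suc d) ≡ 1#
    pow-multiple m = begin
      pow α (m * suc d)            ≡⟨ pow-* α m (suc d) ⟩
      pow (pow α m) (suc d)        ≡⟨ pow-*-comm α m (suc d) ⟩
      pow (pow α (suc d)) m        ≡⟨ cong (λ z → pow z m) αᵈ≡1 ⟩
      pow 1# m                     ≡⟨ pow-1# m ⟩
      1#                           ∎

  nonzero : Fin N → Carrier
  nonzero j = enum (punchIn (index 0#) j)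

  nonzero-≢0 : ∀ j → nonzero j ≢ 0#
  nonzero-≢0 j j≡0 = punchInᵢ≢i (index 0#) j (trans (sym (index-enum _)) (cong index j≡0))

  log : Fin N → ℕ
  log j = proj₁ (α-primitive (nonzero j) (nonzero-≢0 j))

  pow-log : ∀ j → pow α (log j) ≡ nonzero j
  pow-log j = proj₂ (α-primitive (nonzero j) (nonzero-≢0 j))

  -- Every nonzero element is a power of α below its period.
  N≤period : ∀ d → pow α (suc d) ≡ 1# → N ≤ suc d
  N≤period d αᵈ≡1 = injective⇒≤ log-mod-injective
    where
    log-mod : Fin N → Fin (suc d)
    log-mod j = fromℕ< (m%n<n (log j) (suc d))

    log-mod-injective : ∀ {i j} → log-mod i ≡ log-mod j → i ≡ j
    log-mod-injective {i} {j} eq = punchIn-injective (index 0#) i j (enum-injective (begin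
      nonzero i                ≡⟨ sym (pow-log i) ⟩
      pow α (log i)            ≡⟨ sym (pow-α-% d αᵈ≡1 (log i)) ⟩
      pow α (log i % suc d)    ≡⟨ cong (pow α) (toℕ-cancel-fromℕ< eq) ⟩
      pow α (log j % suc d)    ≡⟨ pow-α-% d αᵈ≡1 (log j) ⟩
      pow α (log j)            ≡⟨ pow-log j ⟩
      nonzero j                ∎))
      where
      toℕ-cancel-fromℕ< : log-mod i ≡ log-mod j → log i % suc d ≡ log j % suc d
      toℕ-cancel-fromℕ< e = trans (sym (toℕ-fromℕ< _)) (trans (cong toℕ e) (toℕ-fromℕ< _))

  index-0#≢index-αⁱ : ∀ (i : Fin (suc N)) → index 0# ≢ index (pow α (toℕ i))
  index-0#≢index-αⁱ i eq = pow-α-≢0 (toℕ i) (sym (trans (sym (enum-index 0#)) (trans (cong enum eq) (enum-index _))))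

  -- Among α⁰, …, α^N two coincide, as there are only N nonzero elements.
  period≤N : ∃ λ d → pow α (suc d) ≡ 1# × suc d ≤ N
  period≤N with pigeonhole (ℕ.n<1+n N) (λ i → punchOut (index-0#≢index-αⁱ i))
  ... | i , j , i<j , eq = d , ·-cancelˡ-1 (pow-α-≢0 (toℕ i)) αⁱ⁺ᵈ≡αⁱ , d≤N
    where
    d = toℕ j ∸ suc (toℕ i)
    i+d≡j : toℕ i + suc d ≡ toℕ j
    i+d≡j = trans (ℕ.+-suc (toℕ i) d) (ℕ.m+[n∸m]≡n i<j)
    αⁱ⁺ᵈ≡αⁱ : pow α (toℕ i) · pow α (suc d) ≡ pow α (toℕ i)
    αⁱ⁺ᵈ≡αⁱ = begin
      pow α (toℕ i) · pow α (suc d) ≡⟨ sym (pow-+ α (toℕ i) (suc d)) ⟩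
      pow α (toℕ i + suc d)         ≡⟨ cong (pow α) i+d≡j ⟩
      pow α (toℕ j)                 ≡⟨ sym (enum-index _) ⟩
      enum (index (pow α (toℕ j)))  ≡⟨ cong enum (sym (punchOut-injective (index-0#≢index-αⁱ i) (index-0#≢index-αⁱ j) eq)) ⟩
      enum (index (pow α (toℕ i)))  ≡⟨ enum-index _ ⟩
      pow α (toℕ i)                 ∎
    d≤N : suc d ≤ N
    d≤N = ℕ.≤-trans (ℕ.m≤n+m (suc d) (toℕ i)) (ℕ.≤-trans (ℕ.≤-reflexive i+d≡j) (ℕ.<⇒≤pred (toℕ<n j)))

  order : ∃ λ d → N ≡ suc d × pow α (suc d) ≡ 1#
  order with period≤N
  ... | d , αᵈ≡1 , d≤N = d , ℕ.≤-antisym (N≤period d αᵈ≡1) d≤N , αᵈ≡1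

  pow-α-N : pow α N ≡ 1#
  pow-α-N with order
  ... | d , refl , αᵈ≡1 = αᵈ≡1

  pow-α≡1⇒N∣ : ∀ i → pow α i ≡ 1# → N ∣ i
  pow-α≡1⇒N∣ i αⁱ≡1 with order
  ... | d , refl , αᵈ≡1 = m%n≡0⇒n∣m i (suc d) (remainder≡0 (i % suc d) refl)
    where
    remainder≡0 : ∀ r → i % suc d ≡ r → r ≡ 0
    remainder≡0 zero _ = refl
    remainder≡0 (suc r) i%d≡r = ⊥-elim (ℕ.<⇒≱ (subst (_< suc d) i%d≡r (m%n<n i (suc d)))
      (N≤period r (trans (cong (pow α) (sym i%d≡r)) (trans (pow-α-% d αᵈ≡1 i) αⁱ≡1))))

  pow-α-≢1 : ∀ m → 0 < m → m < N → pow α m ≢ 1#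
  pow-α-≢1 m@(suc _) _ m<N αᵐ≡1 = ℕ.<⇒≱ m<N (∣⇒≤ (pow-α≡1⇒N∣ m αᵐ≡1))

  pow-N : ∀ x → x ≢ 0# → pow x N ≡ 1#
  pow-N x x≢0 with α-primitive x x≢0
  ... | i , refl = trans (pow-*-comm α i N) (trans (cong (λ z → pow z i) pow-α-N) (pow-1# i))

  pow-suc-N : ∀ x → pow x (suc N) ≡ x
  pow-suc-N x with x ≟ 0#
  ... | yes refl = pow-0# N
  ... | no x≢0 = trans (cong (x ·_) (pow-N x x≢0)) (*-identityʳ x)

  0<N : 0 < N
  0<N with order
  ... | d , refl , _ = s≤s z≤n

  pow-α-half : ∀ H → H + H ≡ N → pow α H ≡ - 1#
  pow-α-half zero 0≡N = ⊥-elim (ℕ.<⇒≢ 0<N 0≡N)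
  pow-α-half H@(suc _) H+H≡N
    with x²≡1⇒x≡±1 (pow α H) (trans (sym (pow-+ α H H)) (trans (cong (pow α) H+H≡N) pow-α-N))
  ... | inj₁ αᴴ≡1 = ⊥-elim (pow-α-≢1 H (s≤s z≤n) (subst (H <_) H+H≡N (ℕ.m<m+n H (s≤s z≤n))) αᴴ≡1)
  ... | inj₂ αᴴ≡-1 = αᴴ≡-1

module TraceNondegenerate {N : ℕ} (F : FiniteField (suc N)) {α : FiniteField.Carrier F}
    (α-primitive : Ops.Primitive F α) (α≢0 : α ≢ FiniteField.0# F) (n : ℕ) (3ⁿ≡q : 3 ^ suc n ≡ suc N) where
  open FiniteField F
  open Ops F
  open FieldProperties F
  open Characteristic F using (ι; ι-q≡0)
  open TraceProperties F using (trace≡∑)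
  open Cyclic F α-primitive α≢0 using (pow-α-≢1; pow-N)
  open import Algebra.Properties.Semiring.Sum semiring
    using (sum; sum-syntax; ∑-comm; *-distribˡ-sum; *-distribʳ-sum; sum-cong-≋; sum-replicate; sum-replicate-zero)
  open ≡-Reasoning

  geometric : ∀ z n → (z ⊕ - 1#) · ∑[ j < n ] pow z (toℕ j) ⊕ 1# ≡ pow z n
  geometric z zero = trans (cong (_⊕ 1#) (zeroʳ _)) (+-identityˡ 1#)
  geometric z (suc n) = begin
    (z ⊕ - 1#) · (1# ⊕ ∑[ j < n ] (z · pow z (toℕ j))) ⊕ 1#
                                               ≡⟨ cong (λ s → (z ⊕ - 1#) · (1# ⊕ s) ⊕ 1#) (sym (*-distribˡ-sum {n} z _)) ⟩
    (z ⊕ - 1#) · (1# ⊕ z · G) ⊕ 1#             ≡⟨ solve 3 (λ z m g → (z :+ m) :* (con 1 :+ z :* g) :+ con 1 :=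
                                                          z :* ((z :+ m) :* g :+ con 1) :+ (m :+ con 1)) refl z (- 1#) G ⟩
    z · ((z ⊕ - 1#) · G ⊕ 1#) ⊕ (- 1# ⊕ 1#)    ≡⟨ cong₂ (λ a b → z · a ⊕ b) (geometric z n) (-‿inverseˡ 1#) ⟩
    z · pow z n ⊕ 0#                           ≡⟨ +-identityʳ _ ⟩
    z · pow z n                                ∎
    where
    G = ∑[ j < n ] pow z (toℕ j)

  geometric≡0 : ∀ z → z ≢ 0# → z ≢ 1# → ∑[ j < N ] pow z (toℕ j) ≡ 0#
  geometric≡0 z z≢0 z≢1 with zero-product (z ⊕ - 1#) _ (identityˡ-unique _ 1# (trans (geometric z N) (pow-N z z≢0)))
  ... | inj₁ z-1≡0 = ⊥-elim (z≢1 (x-1≡0⇒x≡1 z-1≡0))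
  ... | inj₂ G≡0 = G≡0

  pow-α-3^≢α : ∀ m → 0 < m → m < suc n → pow α (3 ^ m) ≢ α
  pow-α-3^≢α m 0<m m<1+n αᵉ≡α = pow-α-≢1 e 0<e e<N (·-cancelˡ-1 α≢0 (trans (cong (pow α) (sym 3ᵐ≡1+e)) αᵉ≡α))
    where
    e = 3 ^ m ∸ 1
    3ᵐ≡1+e : 3 ^ m ≡ suc e
    3ᵐ≡1+e = sym (ℕ.m+[n∸m]≡n (ℕ.m^n>0 3 m))
    0<e : 0 < e
    0<e = ℕ.≤-trans (s≤s z≤n) (ℕ.≤-pred (subst (3 ≤_) 3ᵐ≡1+e (ℕ.^-monoʳ-≤ 3 0<m)))
    e<N : e < N
    e<N = ℕ.≤-pred (subst₂ _<_ 3ᵐ≡1+e 3ⁿ≡q (ℕ.^-monoʳ-< 3 (s≤s (s≤s z≤n)) m<1+n))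

  -- Writing Tr(x) = Σᵢ x^{3ⁱ}, the sum Σⱼ Tr(αʲ) α⁻ʲ regroups as Σᵢ Σⱼ (α^{3ⁱ-1})ʲ; only i = 0 contributes.
  root : Fin (suc n) → Carrier
  root i = pow α (3 ^ (toℕ i * 1)) · α ⁻¹

  root-zero : root Fin.zero ≡ 1#
  root-zero = trans (cong (_· α ⁻¹) (pow-1 α)) (inverse α α≢0)

  root-≢0 : ∀ i → root i ≢ 0#
  root-≢0 i = ·-≢0 (pow-≢0 (3 ^ (toℕ i * 1)) α≢0) (⁻¹-≢0 α≢0)

  root-suc-≢1 : ∀ i → root (Fin.suc i) ≢ 1#
  root-suc-≢1 i root≡1 = pow-α-3^≢α (suc (toℕ i) * 1) (subst (0 <_) (sym (ℕ.*-identityʳ (suc (toℕ i)))) (s≤s z≤n))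
    (subst (_< suc n) (sym (ℕ.*-identityʳ (suc (toℕ i)))) (s≤s (toℕ<n i)))
    (·-cancelʳ (⁻¹-≢0 α≢0) (trans root≡1 (sym (inverse α α≢0))))

  ι-N : ι N ≡ - 1#
  ι-N = inverseʳ-unique 1# (ι N) ι-q≡0

  ∑-root-powers : ∑[ i < suc n ] ∑[ j < N ] pow (root i) (toℕ j) ≡ - 1#
  ∑-root-powers = begin
    ∑[ j < N ] pow (root Fin.zero) (toℕ j) ⊕ ∑[ i < n ] ∑[ j < N ] pow (root (Fin.suc i)) (toℕ j)
      ≡⟨ cong₂ _⊕_ (sum-cong-≋ {N} {λ j → pow (root Fin.zero) (toℕ j)} {λ _ → 1#} (λ j → trans (cong (λ z → pow z (toℕ j)) root-zero) (pow-1# (toℕ j))))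
                   (sum-cong-≋ {n} {λ i → ∑[ j < N ] pow (root (Fin.suc i)) (toℕ j)} {λ _ → 0#}
                     (λ i → geometric≡0 (root (Fin.suc i)) (root-≢0 (Fin.suc i)) (root-suc-≢1 i))) ⟩
    sum {N} (λ _ → 1#) ⊕ sum {n} (λ _ → 0#)  ≡⟨ cong₂ _⊕_ (sum-replicate N) (sum-replicate-zero n) ⟩
    ι N ⊕ 0#                                ≡⟨ trans (+-identityʳ _) ι-N ⟩
    - 1#                                    ∎

  weighted-trace-sum : ∑[ j < N ] (trace (suc n) 1 (pow α (toℕ j)) · pow (α ⁻¹) (toℕ j)) ≡ - 1#
  weighted-trace-sum = begin
    ∑[ j < N ] (trace (suc n) 1 (pow α (toℕ j)) · pow (α ⁻¹) (toℕ j))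
      ≡⟨ sum-cong-≋ {N} {λ j → trace (suc n) 1 (pow α (toℕ j)) · pow (α ⁻¹) (toℕ j)} {λ j → ∑[ i < suc n ] pow (root i) (toℕ j)} expand ⟩
    ∑[ j < N ] ∑[ i < suc n ] pow (root i) (toℕ j)
      ≡⟨ ∑-comm {N} {suc n} (λ j i → pow (root i) (toℕ j)) ⟩
    ∑[ i < suc n ] ∑[ j < N ] pow (root i) (toℕ j)
      ≡⟨ ∑-root-powers ⟩
    - 1# ∎
    where
    expand : ∀ j → trace (suc n) 1 (pow α (toℕ j)) · pow (α ⁻¹) (toℕ j) ≡ ∑[ i < suc n ] pow (root i) (toℕ j)
    expand j = begin
      trace (suc n) 1 (pow α (toℕ j)) · pow (α ⁻¹) (toℕ j)
        ≡⟨ cong (_· pow (α ⁻¹) (toℕ j)) (trace≡∑ (suc n) 1 (pow α (toℕ j))) ⟩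
      (∑[ i < suc n ] pow (pow α (toℕ j)) (3 ^ (toℕ i * 1))) · pow (α ⁻¹) (toℕ j)
        ≡⟨ *-distribʳ-sum {suc n} (pow (α ⁻¹) (toℕ j)) (λ i → pow (pow α (toℕ j)) (3 ^ (toℕ i * 1))) ⟩
      ∑[ i < suc n ] (pow (pow α (toℕ j)) (3 ^ (toℕ i * 1)) · pow (α ⁻¹) (toℕ j))
        ≡⟨ sum-cong-≋ {suc n} {λ i → pow (pow α (toℕ j)) (3 ^ (toℕ i * 1)) · pow (α ⁻¹) (toℕ j)} {λ i → pow (root i) (toℕ j)}
             (λ i → trans (cong (_· pow (α ⁻¹) (toℕ j)) (pow-*-comm α (toℕ j) (3 ^ (toℕ i * 1))))
                          (sym (pow-· (pow α (3 ^ (toℕ i * 1))) (α ⁻¹) (toℕ j)))) ⟩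
      ∑[ i < suc n ] pow (root i) (toℕ j) ∎

  ∃trace≢0 : ∃ λ y → trace (suc n) 1 y ≢ 0#
  ∃trace≢0 with ¬∀⟶∃¬ (suc N) (λ i → trace (suc n) 1 (enum i) ≡ 0#) (λ i → trace (suc n) 1 (enum i) ≟ 0#) not-all-zero
    where
    not-all-zero : ¬ (∀ i → trace (suc n) 1 (enum i) ≡ 0#)
    not-all-zero all-zero = -1≢0 (begin
      - 1#                                                                 ≡⟨ sym weighted-trace-sum ⟩
      ∑[ j < N ] (trace (suc n) 1 (pow α (toℕ j)) · pow (α ⁻¹) (toℕ j))
        ≡⟨ sum-cong-≋ {N} {λ j → trace (suc n) 1 (pow α (toℕ j)) · pow (α ⁻¹) (toℕ j)} {λ _ → 0#}
             (λ j → trans (cong (λ y → trace (suc n) 1 y · pow (α ⁻¹) (toℕ j)) (sym (enum-index _)))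
                          (trans (cong (_· pow (α ⁻¹) (toℕ j)) (all-zero (index (pow α (toℕ j))))) (zeroˡ _))) ⟩
      sum {N} (λ _ → 0#)                                                   ≡⟨ sum-replicate-zero N ⟩
      0#                                                                   ∎)
  ... | i , trace≢0 = enum i , trace≢0

∃-trace≢0 : ∀ {N} (F : FiniteField (suc N)) {α : FiniteField.Carrier F} → Ops.Primitive F α → α ≢ FiniteField.0# F →
            ∀ n → 0 < n → 3 ^ n ≡ suc N → ∃ λ y → Ops.trace F n 1 y ≢ FiniteField.0# F
∃-trace≢0 F α-primitive α≢0 (suc n) _ 3ⁿ≡q = TraceNondegenerate.∃trace≢0 F α-primitive α≢0 n 3ⁿ≡q

3ᵏ*3ᵏ≡3²ᵏ : ∀ k → 3 ^ k * 3 ^ k ≡ 3 ^ (2 * k)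
3ᵏ*3ᵏ≡3²ᵏ k = sym (trans (cong (3 ^_) (cong (k +_) (ℕ.+-identityʳ k))) (ℕ.^-distribˡ-+-* 3 k k))

9ʲ≡1+4r : ∀ j → ∃ λ r → 3 ^ (j * 2) ≡ 1 + 4 * r
9ʲ≡1+4r zero = 0 , refl
9ʲ≡1+4r (suc j) with 9ʲ≡1+4r j
... | r , 9ʲ≡1+4r′ = 9 * r + 2 , trans (cong (λ z → 3 * (3 * z)) 9ʲ≡1+4r′) (step r)
  where
  step : ∀ r → 3 * (3 * (1 + 4 * r)) ≡ 1 + 4 * (9 * r + 2)
  step = solve-∀

3^even≡1+4r : ∀ k → k % 2 ≡ 0 → ∃ λ r → 3 ^ k ≡ 1 + 4 * r
3^even≡1+4r k k%2≡0 with 9ʲ≡1+4r (k / 2)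
... | r , 9ʲ≡1+4r′ = r , trans (cong (3 ^_) (trans (m≡m%n+[m/n]*n k 2) (cong (_+ k / 2 * 2) k%2≡0))) 9ʲ≡1+4r′

3^odd≡3+4r : ∀ k → k % 2 ≡ 1 → ∃ λ r → 3 ^ k ≡ 3 + 4 * r
3^odd≡3+4r k k%2≡1 with 9ʲ≡1+4r (k / 2)
... | r , 9ʲ≡1+4r′ = 3 * r , trans (cong (3 ^_) (trans (m≡m%n+[m/n]*n k 2) (cong (_+ k / 2 * 2) k%2≡1)))
                                   (trans (cong (3 *_) 9ʲ≡1+4r′) (step r))
  where
  step : ∀ r → 3 * (1 + 4 * r) ≡ 3 + 4 * (3 * r)
  step = solve-∀

module Exponents (k : ℕ) {N : ℕ} (q≡Q² : 3 ^ k * 3 ^ k ≡ suc N) where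
  Q P : ℕ
  Q = 3 ^ k
  P = Q ∸ 1

  Q≡1+P : Q ≡ suc P
  Q≡1+P = sym (ℕ.m+[n∸m]≡n (ℕ.m^n>0 3 k))

  q≡3^2k : suc N ≡ 3 ^ (2 * k)
  q≡3^2k = trans (sym q≡Q²) (3ᵏ*3ᵏ≡3²ᵏ k)

  N≡P*[Q+1] : N ≡ P * suc Q
  N≡P*[Q+1] = ℕ.suc-injective (begin
    suc N              ≡⟨ sym q≡Q² ⟩
    Q * Q              ≡⟨ cong₂ _*_ Q≡1+P Q≡1+P ⟩
    suc P * suc P      ≡⟨ square-expand P ⟩
    suc (P * (2 + P))  ≡⟨ cong (λ m → suc (P * suc m)) (sym Q≡1+P) ⟩
    suc (P * suc Q)    ∎)
    where
    open ≡-Reasoning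
    square-expand : ∀ p → suc p * suc p ≡ suc (p * (2 + p))
    square-expand = solve-∀

  module Even (r : ℕ) (Q≡1+4[1+r] : Q ≡ 1 + 4 * suc r) where
    h H : ℕ
    h = suc (2 * suc r)
    H = P * h

    P≡4[1+r] : P ≡ 4 * suc r
    P≡4[1+r] = ℕ.suc-injective (trans (sym Q≡1+P) Q≡1+4[1+r])

    [Q∸3]/2≡1+2r : (Q ∸ 3) / 2 ≡ suc (2 * r)
    [Q∸3]/2≡1+2r = trans (cong (λ m → (m ∸ 3) / 2) (trans Q≡1+4[1+r] (identity r))) (m*n/n≡m (suc (2 * r)) 2)
      where
      identity : ∀ r → 1 + 4 * suc r ≡ 3 + suc (2 * r) * 2
      identity = solve-∀

    [2+2r]*2≡P : suc (suc (2 * r)) * 2 ≡ P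
    [2+2r]*2≡P = trans (identity r) (sym P≡4[1+r])
      where
      identity : ∀ r → suc (suc (2 * r)) * 2 ≡ 4 * suc r
      identity = solve-∀

    1+Q≡2h : suc Q ≡ 2 * h
    1+Q≡2h = trans (cong suc Q≡1+4[1+r]) (identity r)
      where
      identity : ∀ r → suc (1 + 4 * suc r) ≡ 2 * suc (2 * suc r)
      identity = solve-∀

    H+H≡N : H + H ≡ N
    H+H≡N = trans (identity P h) (sym (trans N≡P*[Q+1] (cong (P *_) 1+Q≡2h)))
      where
      identity : ∀ p h → p * h + p * h ≡ p * (2 * h)
      identity = solve-∀

    Q+2≡1+2h : Q + 2 ≡ suc (2 * h)
    Q+2≡1+2h = trans (cong (_+ 2) Q≡1+4[1+r]) (identity r)
      where
      identity : ∀ r → 1 + 4 * suc r + 2 ≡ suc (2 * suc (2 * suc r))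
      identity = solve-∀

    [Q+2]*P≡N+P : (Q + 2) * P ≡ N + P
    [Q+2]*P≡N+P = trans (identity Q P) (cong (_+ P) (sym N≡P*[Q+1]))
      where
      identity : ∀ q p → (q + 2) * p ≡ p * suc q + p
      identity = solve-∀

    0<P+P : 0 < P + P
    0<P+P = subst (λ p → 0 < p + p) (sym P≡4[1+r]) (s≤s z≤n)

    P+P<N : P + P < N
    P+P<N = begin-strict
      P + P                                            ≡⟨ cong (λ p → p + p) P≡4[1+r] ⟩
      4 * suc r + 4 * suc r                            <⟨ ℕ.m≤m+n _ _ ⟩
      suc (4 * suc r + 4 * suc r) + (16 * r * r + 32 * r + 15) ≡⟨ identity r ⟩
      4 * suc r * suc (1 + 4 * suc r)                  ≡⟨ sym (cong₂ (λ p q → p * suc q) P≡4[1+r] Q≡1+4[1+r]) ⟩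
      P * suc Q                                        ≡⟨ sym N≡P*[Q+1] ⟩
      N                                                ∎
      where
      open ℕ.≤-Reasoning
      identity : ∀ r → suc (4 * suc r + 4 * suc r) + (16 * r * r + 32 * r + 15) ≡ 4 * suc r * suc (1 + 4 * suc r)
      identity = solve-∀

DistinguishedLine : ∀ {q} (F : FiniteField q) → ℕ → (a₁ a₂ a₃ : FiniteField.Carrier F) → Set
DistinguishedLine F k a₁ a₂ a₃ =
  let open FiniteField F
      open Ops F
  in Σ Carrier λ β → β ≢ 0# × Good k a₁ a₂ β
       × (∀ β′ → β′ ≢ 0# → Good k a₁ a₂ β′ →
            ∀ x → ((InSpan k β x → InSpan k β′ x) × (InSpan k β′ x → InSpan k β x)))
       × (∀ c → InSpan k β c → c ≢ 0# →
            (trace 2 k (a₁ · pow c 2) ≡ 0#) × (trace 2 k (a₂ · pow c 4) ≡ 0#)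
            × (trace 2 k (a₃ · pow c 2) ≡ 0#))
       × (∀ x → InSpan k β x → InSub k x → x ≡ 0#)
       × (k % 2 ≡ 0 →
            (∀ x → Σ Carrier λ v → Σ Carrier λ w →
               InSpan k β v × InPerp k β w × x ≡ v ⊕ w)
            × (∀ x → InSpan k β x → InPerp k β x → x ≡ 0#))
       × (k % 2 ≡ 1 →
            ∀ u v → InSpan k β u → InSpan k β v → trace (2 * k) 1 (u · v) ≡ 0#)

module Subfield {N : ℕ} (F : FiniteField (suc N)) {α : FiniteField.Carrier F}
    (α-primitive : Ops.Primitive F α) (α≢0 : α ≢ FiniteField.0# F) (k : ℕ) (q≡Q² : 3 ^ k * 3 ^ k ≡ suc N) where
  open FiniteField F
  open Ops F
  open FieldProperties F
  open Cyclic F α-primitive α≢0 using (pow-α-≢0; pow-α≡1⇒N∣; pow-suc-N)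
  open Characteristic F using (characteristic-3; frobenius; trace-+)
  open TraceProperties F using (trace-0#; trace-split)
  open Exponents k q≡Q² public
  open ≡-Reasoning

  char-3 : Characteristic.ι F 3 ≡ 0#
  char-3 = characteristic-3 (2 * k) q≡3^2k

  frobenius-Q : ∀ x y → pow (x ⊕ y) Q ≡ pow x Q ⊕ pow y Q
  frobenius-Q = frobenius char-3 k

  pow-Q-Q : ∀ x → pow (pow x Q) Q ≡ x
  pow-Q-Q x = trans (sym (pow-* x Q Q)) (trans (cong (pow x) q≡Q²) (pow-suc-N x))

  InSub-1# : InSub k 1#
  InSub-1# = pow-1# Q

  InSub-· : ∀ {s t} → InSub k s → InSub k t → InSub k (s · t)
  InSub-· {s} {t} sᵠ≡s tᵠ≡t = trans (pow-· s t Q) (cong₂ _·_ sᵠ≡s tᵠ≡t)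

  InSub-⁻¹ : ∀ {t} → t ≢ 0# → InSub k t → InSub k (t ⁻¹)
  InSub-⁻¹ {t} t≢0 tᵠ≡t = ⁻¹-unique t≢0 (trans (cong (pow (t ⁻¹) Q ·_) (sym tᵠ≡t)) (pow-⁻¹ Q t≢0))

  InSub⇒pow-P≡1 : ∀ {t} → t ≢ 0# → InSub k t → pow t P ≡ 1#
  InSub⇒pow-P≡1 {t} t≢0 tᵠ≡t = ·-cancelˡ-1 t≢0 (trans (cong (pow t) (sym Q≡1+P)) tᵠ≡t)

  pow-P≡1⇒InSub : ∀ {t} → pow t P ≡ 1# → InSub k t
  pow-P≡1⇒InSub {t} tᴾ≡1 = trans (cong (pow t) Q≡1+P) (trans (cong (t ·_) tᴾ≡1) (*-identityʳ t))

  relTr : Carrier → Carrier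
  relTr x = x ⊕ pow x Q

  trace-2≡relTr : ∀ x → trace 2 k x ≡ relTr x
  trace-2≡relTr x = cong₂ _⊕_ (trans (+-identityˡ _) (pow-1 x)) (cong (λ e → pow x (3 ^ e)) (ℕ.+-identityʳ k))

  relTr-+ : ∀ x y → relTr (x ⊕ y) ≡ relTr x ⊕ relTr y
  relTr-+ x y = trans (cong ((x ⊕ y) ⊕_) (frobenius-Q x y)) (+-interchange x y (pow x Q) (pow y Q))

  relTr-InSub : ∀ x → InSub k (relTr x)
  relTr-InSub x = trans (frobenius-Q x (pow x Q)) (trans (cong (pow x Q ⊕_) (pow-Q-Q x)) (+-comm _ _))

  relTr-· : ∀ {t} x → InSub k t → relTr (t · x) ≡ t · relTr x
  relTr-· {t} x tᵠ≡t = trans (cong ((t · x) ⊕_) (trans (pow-· t x Q) (cong (_· pow x Q) tᵠ≡t)))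
                             (sym (distribˡ t x (pow x Q)))

  trace≡trace∘relTr : ∀ z → trace (2 * k) 1 z ≡ trace k 1 (relTr z)
  trace≡trace∘relTr z = begin
    trace (2 * k) 1 z                   ≡⟨ cong (λ e → trace (k + e) 1 z) (ℕ.+-identityʳ k) ⟩
    trace (k + k) 1 z                   ≡⟨ trace-split k k 1 z ⟩
    trace k 1 z ⊕ trace k 1 (pow z (3 ^ (k * 1)))
                                        ≡⟨ cong (λ e → trace k 1 z ⊕ trace k 1 (pow z (3 ^ e))) (ℕ.*-identityʳ k) ⟩
    trace k 1 z ⊕ trace k 1 (pow z Q)   ≡⟨ sym (trace-+ char-3 k 1 z (pow z Q)) ⟩
    trace k 1 (relTr z)                 ∎

  trace-·InSub : ∀ {s} x → InSub k s → trace (2 * k) 1 (s · x) ≡ trace k 1 (s · relTr x)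
  trace-·InSub {s} x sᵠ≡s = trans (trace≡trace∘relTr (s · x)) (cong (trace k 1) (relTr-· x sᵠ≡s))

  -- T = αᵐ with (Q+1)P ∣ m(Q+1), so m = cP and β = αᶜ.
  ∃-pow-P≡ : ∀ T → pow T (suc Q) ≡ 1# → ∃ λ β → β ≢ 0# × pow β P ≡ T
  ∃-pow-P≡ T Tᵠ⁺¹≡1 with T ≟ 0#
  ... | yes refl = ⊥-elim (0≢1 (trans (sym (pow-0# Q)) Tᵠ⁺¹≡1))
  ... | no T≢0 with α-primitive T T≢0
  ... | m , refl with pow-α≡1⇒N∣ (m * suc Q) (trans (pow-* α m (suc Q)) Tᵠ⁺¹≡1)
  ... | divides c m[Q+1]≡cN = pow α c , pow-α-≢0 c , trans (sym (pow-* α c P)) (cong (pow α) (sym m≡cP))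
    where
    m≡cP : m ≡ c * P
    m≡cP = ℕ.*-cancelʳ-≡ m (c * P) (suc Q)
      (trans m[Q+1]≡cN (trans (cong (c *_) N≡P*[Q+1]) (sym (ℕ.*-assoc c P (suc Q)))))

  module Line (T : Carrier) (Tᵠ⁺¹≡1 : pow T (suc Q) ≡ 1#) where
    β : Carrier
    β = proj₁ (∃-pow-P≡ T Tᵠ⁺¹≡1)

    β≢0 : β ≢ 0#
    β≢0 = proj₁ (proj₂ (∃-pow-P≡ T Tᵠ⁺¹≡1))

    βᴾ≡T : pow β P ≡ T
    βᴾ≡T = proj₂ (proj₂ (∃-pow-P≡ T Tᵠ⁺¹≡1))

    pow-Q-InSpan : ∀ c → InSpan k β c → pow c Q ≡ c · T
    pow-Q-InSpan c (t , tᵠ≡t , refl) = begin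
      pow (β · t) Q         ≡⟨ pow-· β t Q ⟩
      pow β Q · pow t Q     ≡⟨ cong₂ _·_ (cong (pow β) Q≡1+P) tᵠ≡t ⟩
      (β · pow β P) · t     ≡⟨ cong (λ z → (β · z) · t) βᴾ≡T ⟩
      (β · T) · t           ≡⟨ solve 3 (λ b T t → (b :* T) :* t := (b :* t) :* T) refl β T t ⟩
      (β · t) · T           ∎

    pow-P-InSpan : ∀ c → InSpan k β c → c ≢ 0# → pow c P ≡ T
    pow-P-InSpan c c∈V c≢0 = ·-cancelˡ c≢0 (trans (cong (pow c) (sym Q≡1+P)) (pow-Q-InSpan c c∈V))

    InSpan-unique : ∀ β′ → β′ ≢ 0# → pow β′ P ≡ T →
                    ∀ x → (InSpan k β x → InSpan k β′ x) × (InSpan k β′ x → InSpan k β x)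
    InSpan-unique β′ β′≢0 β′ᴾ≡T x = to , from
      where
      r : Carrier
      r = β′ · β ⁻¹
      r≢0 : r ≢ 0#
      r≢0 = ·-≢0 β′≢0 (⁻¹-≢0 β≢0)
      r∈Fq : InSub k r
      r∈Fq = pow-P≡1⇒InSub (begin
        pow (β′ · β ⁻¹) P          ≡⟨ pow-· β′ (β ⁻¹) P ⟩
        pow β′ P · pow (β ⁻¹) P    ≡⟨ cong (_· pow (β ⁻¹) P) (trans β′ᴾ≡T (sym βᴾ≡T)) ⟩
        pow β P · pow (β ⁻¹) P     ≡⟨ *-comm _ _ ⟩
        pow (β ⁻¹) P · pow β P     ≡⟨ pow-⁻¹ P β≢0 ⟩
        1#                         ∎)
      rβ≡β′ : r · β ≡ β′
      rβ≡β′ = trans (*-assoc _ _ _) (trans (cong (β′ ·_) (inverseˡ β β≢0)) (*-identityʳ β′))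
      to : InSpan k β x → InSpan k β′ x
      to (t , t∈Fq , refl) = r ⁻¹ · t , InSub-· (InSub-⁻¹ r≢0 r∈Fq) t∈Fq , (begin
        β · t                    ≡⟨ sym (*-identityˡ _) ⟩
        1# · (β · t)             ≡⟨ cong (_· (β · t)) (sym (inverse r r≢0)) ⟩
        (r · r ⁻¹) · (β · t)     ≡⟨ *-interchange r (r ⁻¹) β t ⟩
        (r · β) · (r ⁻¹ · t)     ≡⟨ cong (_· (r ⁻¹ · t)) rβ≡β′ ⟩
        β′ · (r ⁻¹ · t)          ∎)
      from : InSpan k β′ x → InSpan k β x
      from (t , t∈Fq , refl) = r · t , InSub-· r∈Fq t∈Fq , (begin
        β′ · t          ≡⟨ cong (_· t) (sym rβ≡β′) ⟩
        (r · β) · t     ≡⟨ solve 3 (λ r b t → (r :* b) :* t := b :* (r :* t)) refl r β t ⟩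
        β · (r · t)     ∎)

    relTr-InSpan≡0 : ∀ a e → pow a P · pow T e ≡ - 1# → ∀ c → InSpan k β c → relTr (a · pow c e) ≡ 0#
    relTr-InSpan≡0 a e aᴾTᵉ≡-1 c c∈V = trans (cong (a · pow c e ⊕_) conjugate) (trans (cong (a · pow c e ⊕_) (-1*x≈-x _)) (-‿inverseʳ _))
      where
      conjugate : pow (a · pow c e) Q ≡ - 1# · (a · pow c e)
      conjugate = begin
        pow (a · pow c e) Q                    ≡⟨ pow-· a (pow c e) Q ⟩
        pow a Q · pow (pow c e) Q              ≡⟨ cong₂ _·_ (cong (pow a) Q≡1+P) (pow-*-comm c e Q) ⟩
        (a · pow a P) · pow (pow c Q) e        ≡⟨ cong (λ z → (a · pow a P) · pow z e) (pow-Q-InSpan c c∈V) ⟩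
        (a · pow a P) · pow (c · T) e          ≡⟨ cong ((a · pow a P) ·_) (pow-· c T e) ⟩
        (a · pow a P) · (pow c e · pow T e)    ≡⟨ solve 4 (λ a A C E → (a :* A) :* (C :* E) := (A :* E) :* (a :* C)) refl a (pow a P) (pow c e) (pow T e) ⟩
        (pow a P · pow T e) · (a · pow c e)    ≡⟨ cong (_· (a · pow c e)) aᴾTᵉ≡-1 ⟩
        - 1# · (a · pow c e)                   ∎

    InSpan∩InSub≡0 : T ≢ 1# → ∀ x → InSpan k β x → InSub k x → x ≡ 0#
    InSpan∩InSub≡0 T≢1 x x∈V x∈Fq with x ≟ 0#
    ... | yes x≡0 = x≡0
    ... | no x≢0 = ⊥-elim (T≢1 (trans (sym (pow-P-InSpan x x∈V x≢0)) (InSub⇒pow-P≡1 x≢0 x∈Fq)))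

    B : Carrier
    B = relTr (β · β)

    B≡β²[1+T²] : B ≡ (β · β) · (1# ⊕ pow T 2)
    B≡β²[1+T²] = begin
      β · β ⊕ pow (β · β) Q           ≡⟨ cong (β · β ⊕_) (trans (pow-· β β Q) (cong₂ _·_ βᵠ≡βT βᵠ≡βT)) ⟩
      β · β ⊕ (β · T) · (β · T)       ≡⟨ solve 2 (λ b t → b :* b :+ (b :* t) :* (b :* t) := (b :* b) :* (con 1 :+ t :* (t :* con 1))) refl β T ⟩
      (β · β) · (1# ⊕ pow T 2)        ∎
      where
      βᵠ≡βT : pow β Q ≡ β · T
      βᵠ≡βT = pow-Q-InSpan β (1# , InSub-1# , sym (*-identityʳ β))

    trace-·InSpan : ∀ x s → InSub k s → trace (2 * k) 1 (x · (β · s)) ≡ trace k 1 (s · relTr (x · β))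
    trace-·InSpan x s s∈Fq = trans (cong (trace (2 * k) 1) (solve 3 (λ x b s → x :* (b :* s) := s :* (x :* b)) refl x β s))
                                   (trace-·InSub (x · β) s∈Fq)

    relTr-β·t·β : ∀ {t} → InSub k t → relTr ((β · t) · β) ≡ t · B
    relTr-β·t·β {t} t∈Fq = trans (cong relTr (solve 2 (λ b t → (b :* t) :* b := t :* (b :* b)) refl β t)) (relTr-· (β · β) t∈Fq)

    selfOrthogonal : pow T 2 ≡ - 1# → ∀ u v → InSpan k β u → InSpan k β v → trace (2 * k) 1 (u · v) ≡ 0#
    selfOrthogonal T²≡-1 _ _ (t , t∈Fq , refl) (s , s∈Fq , refl) = begin
      trace (2 * k) 1 ((β · t) · (β · s))    ≡⟨ trace-·InSpan (β · t) s s∈Fq ⟩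
      trace k 1 (s · relTr ((β · t) · β))    ≡⟨ cong (λ z → trace k 1 (s · z)) (trans (relTr-β·t·β t∈Fq) (cong (t ·_) B≡0)) ⟩
      trace k 1 (s · (t · 0#))               ≡⟨ cong (trace k 1) (trans (cong (s ·_) (zeroʳ t)) (zeroʳ s)) ⟩
      trace k 1 0#                           ≡⟨ trace-0# k 1 ⟩
      0#                                     ∎
      where
      B≡0 : B ≡ 0#
      B≡0 = trans B≡β²[1+T²] (trans (cong (λ z → (β · β) · (1# ⊕ z)) T²≡-1) (trans (cong ((β · β) ·_) (-‿inverseʳ 1#)) (zeroʳ _)))

    module Supplementary (T²≢-1 : pow T 2 ≢ - 1#) where
      B≢0 : B ≢ 0#
      B≢0 B≡0 with zero-product (β · β) (1# ⊕ pow T 2) (trans (sym B≡β²[1+T²]) B≡0)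
      ... | inj₁ β²≡0 = ·-≢0 β≢0 β≢0 β²≡0
      ... | inj₂ 1+T²≡0 = T²≢-1 (inverseʳ-unique 1# (pow T 2) 1+T²≡0)

      -- The projection onto V along V⊥ is x ↦ β · relTr (x β) / relTr (β²).
      decomposition : ∀ x → Σ Carrier λ v → Σ Carrier λ w → InSpan k β v × InPerp k β w × x ≡ v ⊕ w
      decomposition x = β · t , x ⊕ - (β · t) , (t , t∈Fq , refl) , w⊥V , x≡v+[x-v] x (β · t)
        where
        t : Carrier
        t = relTr (x · β) · B ⁻¹
        t∈Fq : InSub k t
        t∈Fq = InSub-· (relTr-InSub (x · β)) (InSub-⁻¹ B≢0 (relTr-InSub (β · β)))
        relTr-vβ≡relTr-xβ : relTr ((β · t) · β) ≡ relTr (x · β)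
        relTr-vβ≡relTr-xβ = begin
          relTr ((β · t) · β)             ≡⟨ relTr-β·t·β t∈Fq ⟩
          (relTr (x · β) · B ⁻¹) · B      ≡⟨ *-assoc _ _ _ ⟩
          relTr (x · β) · (B ⁻¹ · B)      ≡⟨ cong (relTr (x · β) ·_) (inverseˡ B B≢0) ⟩
          relTr (x · β) · 1#              ≡⟨ *-identityʳ _ ⟩
          relTr (x · β)                   ∎
        relTr-wβ≡0 : relTr ((x ⊕ - (β · t)) · β) ≡ 0#
        relTr-wβ≡0 = identityˡ-unique _ (relTr ((β · t) · β)) (begin
          relTr ((x ⊕ - (β · t)) · β) ⊕ relTr ((β · t) · β)   ≡⟨ sym (relTr-+ _ _) ⟩
          relTr ((x ⊕ - (β · t)) · β ⊕ (β · t) · β)           ≡⟨ cong relTr (sym (distribʳ β _ _)) ⟩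
          relTr (((x ⊕ - (β · t)) ⊕ β · t) · β)              ≡⟨ cong (λ z → relTr (z · β)) (trans (+-comm _ _) (sym (x≡v+[x-v] x (β · t)))) ⟩
          relTr (x · β)                                      ≡⟨ sym relTr-vβ≡relTr-xβ ⟩
          relTr ((β · t) · β)                                ∎)
        w⊥V : InPerp k β (x ⊕ - (β · t))
        w⊥V _ (s , s∈Fq , refl) = begin
          trace (2 * k) 1 ((x ⊕ - (β · t)) · (β · s))   ≡⟨ trace-·InSpan _ s s∈Fq ⟩
          trace k 1 (s · relTr ((x ⊕ - (β · t)) · β))   ≡⟨ cong (λ z → trace k 1 (s · z)) relTr-wβ≡0 ⟩
          trace k 1 (s · 0#)                            ≡⟨ cong (trace k 1) (zeroʳ s) ⟩
          trace k 1 0#                                  ≡⟨ trace-0# k 1 ⟩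
          0#                                            ∎

      -- For x = βt ≠ 0 in V⊥, Tr_k(s · tB) = 0 for every s ∈ F_{3^k}; taking s = relTr y / tB gives Tr_n y = 0.
      InSpan∩InPerp≡0 : 0 < k → ∀ x → InSpan k β x → InPerp k β x → x ≡ 0#
      InSpan∩InPerp≡0 0<k _ (t , t∈Fq , refl) x⊥V with t ≟ 0#
      ... | yes t≡0 = trans (cong (β ·_) t≡0) (zeroʳ β)
      ... | no t≢0 = ⊥-elim (proj₂ nondegenerate (begin
        trace (2 * k) 1 y                              ≡⟨ trace≡trace∘relTr y ⟩
        trace k 1 (relTr y)                            ≡⟨ cong (trace k 1) (sym s·tB≡relTr-y) ⟩
        trace k 1 (s · (t · B))                        ≡⟨ cong (λ z → trace k 1 (s · z)) (sym (relTr-β·t·β t∈Fq)) ⟩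
        trace k 1 (s · relTr ((β · t) · β))            ≡⟨ sym (trace-·InSpan (β · t) s s∈Fq) ⟩
        trace (2 * k) 1 ((β · t) · (β · s))            ≡⟨ x⊥V (β · s) (s , s∈Fq , refl) ⟩
        0#                                             ∎))
        where
        nondegenerate : ∃ λ y → trace (2 * k) 1 y ≢ 0#
        nondegenerate = ∃-trace≢0 F α-primitive α≢0 (2 * k) (ℕ.<-≤-trans 0<k (ℕ.m≤m+n k _)) (sym q≡3^2k)
        y = proj₁ nondegenerate
        tB≢0 : t · B ≢ 0#
        tB≢0 = ·-≢0 t≢0 B≢0
        s : Carrier
        s = relTr y · (t · B) ⁻¹
        s∈Fq : InSub k s
        s∈Fq = InSub-· (relTr-InSub y) (InSub-⁻¹ tB≢0 (InSub-· t∈Fq (relTr-InSub (β · β))))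
        s·tB≡relTr-y : s · (t · B) ≡ relTr y
        s·tB≡relTr-y = trans (*-assoc _ _ _) (trans (cong (relTr y ·_) (inverseˡ _ tB≢0)) (*-identityʳ _))

  distinguishedLine : ∀ {a₁ a₂ a₃ T} → 0 < k → a₁ ≢ 0# → a₂ ≡ a₁ · T → pow T (suc Q) ≡ 1# → T ≢ 1# →
                      pow a₁ P · pow T 2 ≡ - 1# → pow a₃ P ≡ pow a₁ P →
                      (k % 2 ≡ 1 → pow T 2 ≡ - 1#) → (k % 2 ≡ 0 → pow T 2 ≢ - 1#) →
                      DistinguishedLine F k a₁ a₂ a₃
  distinguishedLine {a₁} {a₂} {a₃} {T} 0<k a₁≢0 a₂≡a₁T Tᵠ⁺¹≡1 T≢1 a₁ᴾT²≡-1 a₃ᴾ≡a₁ᴾ odd⇒T²≡-1 even⇒T²≢-1 =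
    β , β≢0 , good , unique , traces , InSpan∩InSub≡0 T≢1 , supplementary , selfOrthogonal ∘ odd⇒T²≡-1
    where
    open Line T Tᵠ⁺¹≡1

    good : Good k a₁ a₂ β
    good c c∈V c≢0 = trans (cong (a₁ ·_) (pow-P-InSpan c c∈V c≢0)) (sym a₂≡a₁T)

    unique : ∀ β′ → β′ ≢ 0# → Good k a₁ a₂ β′ → ∀ x → (InSpan k β x → InSpan k β′ x) × (InSpan k β′ x → InSpan k β x)
    unique β′ β′≢0 good′ = InSpan-unique β′ β′≢0
      (·-cancelˡ a₁≢0 (trans (good′ β′ (1# , InSub-1# , sym (*-identityʳ β′)) β′≢0) a₂≡a₁T))

    a₂ᴾT⁴≡-1 : pow a₂ P · pow T 4 ≡ - 1#
    a₂ᴾT⁴≡-1 = begin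
      pow a₂ P · pow T 4                    ≡⟨ cong (λ z → pow z P · pow T 4) a₂≡a₁T ⟩
      pow (a₁ · T) P · pow T 4              ≡⟨ cong (_· pow T 4) (pow-· a₁ T P) ⟩
      (pow a₁ P · pow T P) · pow T 4        ≡⟨ trans (*-assoc _ _ _) (cong (pow a₁ P ·_) (sym (pow-+ T P 4))) ⟩
      pow a₁ P · pow T (P + 4)              ≡⟨ cong (λ e → pow a₁ P · pow T e) P+4≡Q+1+2 ⟩
      pow a₁ P · pow T (suc Q + 2)          ≡⟨ cong (pow a₁ P ·_) (trans (pow-+ T (suc Q) 2) (cong (_· pow T 2) Tᵠ⁺¹≡1)) ⟩
      pow a₁ P · (1# · pow T 2)             ≡⟨ cong (pow a₁ P ·_) (*-identityˡ _) ⟩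
      pow a₁ P · pow T 2                    ≡⟨ a₁ᴾT²≡-1 ⟩
      - 1#                                  ∎
      where
      P+4≡Q+1+2 : P + 4 ≡ suc Q + 2
      P+4≡Q+1+2 = trans (shuffle P) (cong (λ m → suc m + 2) (sym Q≡1+P))
        where
        shuffle : ∀ p → p + 4 ≡ suc (suc p) + 2
        shuffle = solve-∀

    traces : ∀ c → InSpan k β c → c ≢ 0# →
             (trace 2 k (a₁ · pow c 2) ≡ 0#) × (trace 2 k (a₂ · pow c 4) ≡ 0#) × (trace 2 k (a₃ · pow c 2) ≡ 0#)
    traces c c∈V _ = vanishes a₁ 2 a₁ᴾT²≡-1 , vanishes a₂ 4 a₂ᴾT⁴≡-1 ,
                     vanishes a₃ 2 (trans (cong (_· pow T 2) a₃ᴾ≡a₁ᴾ) a₁ᴾT²≡-1)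
      where
      vanishes : ∀ a e → pow a P · pow T e ≡ - 1# → trace 2 k (a · pow c e) ≡ 0#
      vanishes a e aᴾTᵉ≡-1 = trans (trace-2≡relTr _) (relTr-InSpan≡0 a e aᴾTᵉ≡-1 c c∈V)

    supplementary : k % 2 ≡ 0 →
                    (∀ x → Σ Carrier λ v → Σ Carrier λ w → InSpan k β v × InPerp k β w × x ≡ v ⊕ w)
                    × (∀ x → InSpan k β x → InPerp k β x → x ≡ 0#)
    supplementary even = decomposition , InSpan∩InPerp≡0 0<k
      where open Supplementary (even⇒T²≢-1 even)

module Coefficients {N : ℕ} (F : FiniteField (suc N)) (k : ℕ) (0<k : 0 < k) (q≡Q² : 3 ^ k * 3 ^ k ≡ suc N)
    {α I s : FiniteField.Carrier F} (α-primitive : Ops.Primitive F α) (I-primitive : Ops.Primitive4thRoot F I)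
    (s≡±1 : s ≡ FiniteField.1# F ⊎ s ≡ FiniteField.-_ F (FiniteField.1# F)) where
  open FiniteField F
  open Ops F
  open FieldProperties F
  open ≡-Reasoning

  -1≢1 : - 1# ≢ 1#
  -1≢1 = Characteristic.-1≢1 F (Characteristic.characteristic-3 F (2 * k) (Exponents.q≡3^2k k q≡Q²))

  α≢0 : α ≢ 0#
  α≢0 α≡0 with α-primitive (- 1#) -1≢0
  ... | zero , 1≡-1 = -1≢1 (sym 1≡-1)
  ... | suc i , αⁱ≡-1 = -1≢0 (trans (sym αⁱ≡-1) (trans (cong (λ z → pow z (suc i)) α≡0) (pow-0# i)))

  open Subfield F α-primitive α≢0 k q≡Q²

  I²≡-1 : pow I 2 ≡ - 1#
  I²≡-1 with x²≡1⇒x≡±1 (pow I 2) (trans (sym (pow-2 (pow I 2))) (trans (sym (pow-* I 2 2)) (proj₁ I-primitive)))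
  ... | inj₁ I²≡1 = ⊥-elim (proj₂ I-primitive I²≡1)
  ... | inj₂ I²≡-1 = I²≡-1

  s²≡1 : pow s 2 ≡ 1#
  s²≡1 = square s≡±1
    where
    square : ∀ {x} → x ≡ 1# ⊎ x ≡ - 1# → pow x 2 ≡ 1#
    square (inj₁ refl) = pow-1# 2
    square (inj₂ refl) = trans (pow-2 (- 1#)) -1·-1≡1

  [sI]²≡-1 : pow (s · I) 2 ≡ - 1#
  [sI]²≡-1 = trans (pow-· s I 2) (trans (cong₂ _·_ s²≡1 I²≡-1) (*-identityˡ _))

  parity-absurd : k % 2 ≡ 1 → k % 2 ≡ 0 → ⊥
  parity-absurd odd even with trans (sym odd) even
  ... | ()

  oddCase : k % 2 ≡ 1 → DistinguishedLine F k 1# (s · I) 1#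
  oddCase odd = distinguishedLine 0<k 1≢0 (sym (*-identityˡ _)) T^[Q+1]≡1 T≢1
    (trans (cong₂ _·_ (pow-1# P) [sI]²≡-1) (*-identityˡ _)) refl (λ _ → [sI]²≡-1) (λ even _ → parity-absurd odd even)
    where
    T^[Q+1]≡1 : pow (s · I) (suc Q) ≡ 1#
    T^[Q+1]≡1 with 3^odd≡3+4r k odd
    ... | r , Q≡3+4r = begin
      pow (s · I) (suc Q)              ≡⟨ cong (pow (s · I)) (trans (cong suc Q≡3+4r) (sym (ℕ.*-suc 4 r))) ⟩
      pow (s · I) (4 * suc r)          ≡⟨ pow-* (s · I) 4 (suc r) ⟩
      pow (pow (s · I) 4) (suc r)      ≡⟨ cong (λ z → pow z (suc r)) (trans (pow-* (s · I) 2 2) (cong (λ z → pow z 2) [sI]²≡-1)) ⟩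
      pow (pow (- 1#) 2) (suc r)       ≡⟨ cong (λ z → pow z (suc r)) (pow-−1-even 1) ⟩
      pow 1# (suc r)                   ≡⟨ pow-1# (suc r) ⟩
      1#                               ∎
    T≢1 : s · I ≢ 1#
    T≢1 sI≡1 = -1≢1 (trans (sym [sI]²≡-1) (trans (cong (λ z → pow z 2) sI≡1) (pow-1# 2)))

  open Cyclic F α-primitive α≢0 using (pow-α-≢0; pow-α-N; pow-α-≢1; pow-α-half)

  module EvenCase (r : ℕ) (Q≡1+4[1+r] : Q ≡ 1 + 4 * suc r) where
    open Even r Q≡1+4[1+r]

    a₁ u U T : Carrier
    a₁ = pow α (3 ^ k + 2)
    u = a₁ ⁻¹
    U = pow u P
    T = s · I · pow u (suc (suc (2 * r)))

    a₁≢0 : a₁ ≢ 0#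
    a₁≢0 = pow-α-≢0 (3 ^ k + 2)

    a₁ᴾ·U≡1 : pow a₁ P · U ≡ 1#
    a₁ᴾ·U≡1 = trans (*-comm _ _) (pow-⁻¹ P a₁≢0)

    a₁ᴾ≡αᴾ : pow a₁ P ≡ pow α P
    a₁ᴾ≡αᴾ = begin
      pow (pow α (Q + 2)) P       ≡⟨ sym (pow-* α (Q + 2) P) ⟩
      pow α ((Q + 2) * P)         ≡⟨ cong (pow α) [Q+2]*P≡N+P ⟩
      pow α (N + P)               ≡⟨ pow-+ α N P ⟩
      pow α N · pow α P           ≡⟨ cong (_· pow α P) pow-α-N ⟩
      1# · pow α P                ≡⟨ *-identityˡ _ ⟩
      pow α P                     ∎

    a₁ᴴ≡-1 : pow a₁ H ≡ - 1#
    a₁ᴴ≡-1 = begin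
      pow (pow α (Q + 2)) H       ≡⟨ pow-*-comm α (Q + 2) H ⟩
      pow (pow α H) (Q + 2)       ≡⟨ cong₂ pow (pow-α-half H H+H≡N) Q+2≡1+2h ⟩
      pow (- 1#) (suc (2 * h))    ≡⟨ pow-−1-odd h ⟩
      - 1#                        ∎

    uᴴ≡-1 : pow u H ≡ - 1#
    uᴴ≡-1 = ·-cancelʳ -1≢0 (trans (cong (pow u H ·_) (sym a₁ᴴ≡-1)) (trans (pow-⁻¹ H a₁≢0) (sym -1·-1≡1)))

    T²≡-U : pow T 2 ≡ - 1# · U
    T²≡-U = begin
      pow (s · I · pow u (suc (suc (2 * r)))) 2               ≡⟨ pow-· (s · I) _ 2 ⟩
      pow (s · I) 2 · pow (pow u (suc (suc (2 * r)))) 2       ≡⟨ cong₂ _·_ [sI]²≡-1 (sym (pow-* u (suc (suc (2 * r))) 2)) ⟩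
      - 1# · pow u (suc (suc (2 * r)) * 2)                    ≡⟨ cong (λ e → - 1# · pow u e) [2+2r]*2≡P ⟩
      - 1# · U                                                ∎

    a₂≡a₁T : s · I · pow u ((3 ^ k ∸ 3) / 2) ≡ a₁ · T
    a₂≡a₁T = begin
      s · I · pow u ((Q ∸ 3) / 2)             ≡⟨ cong (λ e → s · I · pow u e) [Q∸3]/2≡1+2r ⟩
      s · I · pow u (suc (2 * r))             ≡⟨ sym (*-identityˡ _) ⟩
      1# · (s · I · pow u (suc (2 * r)))      ≡⟨ cong (_· (s · I · pow u (suc (2 * r)))) (sym (inverse a₁ a₁≢0)) ⟩
      (a₁ · u) · (s · I · pow u (suc (2 * r))) ≡⟨ solve 4 (λ a u t p → (a :* u) :* (t :* p) := a :* (t :* (u :* p))) refl a₁ u (s · I) (pow u (suc (2 * r))) ⟩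
      a₁ · T                                  ∎

    a₁ᴾT²≡-1 : pow a₁ P · pow T 2 ≡ - 1#
    a₁ᴾT²≡-1 = begin
      pow a₁ P · pow T 2          ≡⟨ cong (pow a₁ P ·_) T²≡-U ⟩
      pow a₁ P · (- 1# · U)       ≡⟨ solve 3 (λ a m u → a :* (m :* u) := m :* (a :* u)) refl (pow a₁ P) (- 1#) U ⟩
      - 1# · (pow a₁ P · U)       ≡⟨ cong (- 1# ·_) a₁ᴾ·U≡1 ⟩
      - 1# · 1#                   ≡⟨ *-identityʳ _ ⟩
      - 1#                        ∎

    T^[Q+1]≡1 : pow T (suc Q) ≡ 1#
    T^[Q+1]≡1 = begin
      pow T (suc Q)                       ≡⟨ trans (cong (pow T) 1+Q≡2h) (pow-* T 2 h) ⟩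
      pow (pow T 2) h                     ≡⟨ cong (λ z → pow z h) T²≡-U ⟩
      pow (- 1# · U) h                    ≡⟨ pow-· (- 1#) U h ⟩
      pow (- 1#) h · pow U h              ≡⟨ cong₂ _·_ (pow-−1-odd (suc r)) (sym (pow-* u P h)) ⟩
      - 1# · pow u H                      ≡⟨ cong (- 1# ·_) uᴴ≡-1 ⟩
      - 1# · - 1#                         ≡⟨ -1·-1≡1 ⟩
      1#                                  ∎

    -- αᴾ has order Q + 1 > 2, so it is neither 1 nor -1.
    αᴾ·αᴾ≢1 : pow α P · pow α P ≢ 1#
    αᴾ·αᴾ≢1 αᴾ⁺ᴾ≡1 = pow-α-≢1 (P + P) 0<P+P P+P<N (trans (pow-+ α P P) αᴾ⁺ᴾ≡1)

    U·U≢1 : U · U ≢ 1#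
    U·U≢1 U²≡1 = αᴾ·αᴾ≢1 (begin
      pow α P · pow α P                           ≡⟨ sym (*-identityʳ _) ⟩
      (pow α P · pow α P) · 1#                    ≡⟨ cong₂ (λ a b → (a · a) · b) (sym a₁ᴾ≡αᴾ) (sym U²≡1) ⟩
      (pow a₁ P · pow a₁ P) · (U · U)             ≡⟨ solve 2 (λ a u → (a :* a) :* (u :* u) := (a :* u) :* (a :* u)) refl (pow a₁ P) U ⟩
      (pow a₁ P · U) · (pow a₁ P · U)             ≡⟨ cong₂ _·_ a₁ᴾ·U≡1 a₁ᴾ·U≡1 ⟩
      1# · 1#                                     ≡⟨ *-identityʳ 1# ⟩
      1#                                          ∎)

    U≡-T² : U ≡ - 1# · pow T 2
    U≡-T² = sym (begin
      - 1# · pow T 2           ≡⟨ cong (- 1# ·_) T²≡-U ⟩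
      - 1# · (- 1# · U)        ≡⟨ sym (*-assoc _ _ _) ⟩
      (- 1# · - 1#) · U        ≡⟨ cong (_· U) -1·-1≡1 ⟩
      1# · U                   ≡⟨ *-identityˡ U ⟩
      U                        ∎)

    T≢1 : T ≢ 1#
    T≢1 T≡1 = U·U≢1 (begin
      U · U                                    ≡⟨ cong (λ z → z · z) (trans U≡-T² (cong (λ t → - 1# · pow t 2) T≡1)) ⟩
      (- 1# · pow 1# 2) · (- 1# · pow 1# 2)    ≡⟨ cong (λ z → (- 1# · z) · (- 1# · z)) (pow-1# 2) ⟩
      (- 1# · 1#) · (- 1# · 1#)                ≡⟨ cong (λ z → z · z) (*-identityʳ _) ⟩
      - 1# · - 1#                              ≡⟨ -1·-1≡1 ⟩
      1#                                       ∎)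

    T²≢-1 : pow T 2 ≢ - 1#
    T²≢-1 T²≡-1 = U·U≢1 (begin
      U · U                        ≡⟨ cong (λ z → z · z) (trans U≡-T² (cong (- 1# ·_) T²≡-1)) ⟩
      (- 1# · - 1#) · (- 1# · - 1#) ≡⟨ cong (λ z → z · z) -1·-1≡1 ⟩
      1# · 1#                      ≡⟨ *-identityʳ 1# ⟩
      1#                           ∎)

  evenCase : k % 2 ≡ 0 → let a₁ = pow α (3 ^ k + 2) in DistinguishedLine F k a₁ (s · I · pow (a₁ ⁻¹) ((3 ^ k ∸ 3) / 2)) α
  evenCase even with 3^even≡1+4r k even
  ... | zero , Q≡1 = ⊥-elim (ℕ.<⇒≢ (ℕ.^-monoʳ-< 3 (s≤s (s≤s z≤n)) 0<k) (sym Q≡1))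
  ... | suc r , Q≡1+4[1+r] = distinguishedLine 0<k a₁≢0 a₂≡a₁T T^[Q+1]≡1 T≢1
          a₁ᴾT²≡-1 (sym a₁ᴾ≡αᴾ) (λ odd → ⊥-elim (parity-absurd odd even)) (λ _ → T²≢-1)
    where open EvenCase r Q≡1+4[1+r]

lemma2-at-order : ∀ {q} (F : FiniteField q) k → 0 < k → 3 ^ k * 3 ^ k ≡ q →
  let open FiniteField F
      open Ops F
  in (α I s a₁ a₂ a₃ : Carrier) → Primitive α → Primitive4thRoot I →
     (s ≡ 1# ⊎ s ≡ - 1#) →
     ((k % 2 ≡ 1 × a₁ ≡ 1# × a₃ ≡ 1# × a₂ ≡ s · I)
      ⊎ (k % 2 ≡ 0 × a₁ ≡ pow α (3 ^ k + 2) × a₃ ≡ α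
         × a₂ ≡ s · I · pow (a₁ ⁻¹) ((3 ^ k ∸ 3) / 2))) →
     DistinguishedLine F k a₁ a₂ a₃
lemma2-at-order {zero} F _ _ _ = ⊥-elim (¬Fin0 (FieldProperties.index F (FiniteField.0# F)))
lemma2-at-order {suc N} F k 0<k q≡Q² α I s _ _ _ α-primitive I-primitive s≡±1 (inj₁ (odd , refl , refl , refl)) =
  Coefficients.oddCase F k 0<k q≡Q² α-primitive I-primitive s≡±1 odd
lemma2-at-order {suc N} F k 0<k q≡Q² α I s _ _ _ α-primitive I-primitive s≡±1 (inj₂ (even , refl , refl , refl)) =
  Coefficients.evenCase F k 0<k q≡Q² α-primitive I-primitive s≡±1 even

lemma2 : (k : ℕ) → 1 < k → (F : FiniteField (3 ^ (2 * k))) →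
  let open FiniteField F
      open Ops F
  in (α I s a₁ a₂ a₃ : Carrier) → Primitive α → Primitive4thRoot I →
     (s ≡ 1# ⊎ s ≡ - 1#) →
     ((k % 2 ≡ 1 × a₁ ≡ 1# × a₃ ≡ 1# × a₂ ≡ s · I)
      ⊎ (k % 2 ≡ 0 × a₁ ≡ pow α (3 ^ k + 2) × a₃ ≡ α
         × a₂ ≡ s · I · pow (a₁ ⁻¹) ((3 ^ k ∸ 3) / 2))) →
     Σ Carrier λ β → β ≢ 0# × Good k a₁ a₂ β
       × (∀ β′ → β′ ≢ 0# → Good k a₁ a₂ β′ →
            ∀ x → ((InSpan k β x → InSpan k β′ x) × (InSpan k β′ x → InSpan k β x)))
       × (∀ c → InSpan k β c → c ≢ 0# →
            (trace 2 k (a₁ · pow c 2) ≡ 0#) × (trace 2 k (a₂ · pow c 4) ≡ 0#)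
            × (trace 2 k (a₃ · pow c 2) ≡ 0#))
       × (∀ x → InSpan k β x → InSub k x → x ≡ 0#)
       × (k % 2 ≡ 0 →
            (∀ x → Σ Carrier λ v → Σ Carrier λ w →
               InSpan k β v × InPerp k β w × x ≡ v ⊕ w)
            × (∀ x → InSpan k β x → InPerp k β x → x ≡ 0#))
       × (k % 2 ≡ 1 →
            ∀ u v → InSpan k β u → InSpan k β v → trace (2 * k) 1 (u · v) ≡ 0#)
lemma2 k 1<k F = lemma2-at-order F k (ℕ.<-trans (s≤s z≤n) 1<k) (3ᵏ*3ᵏ≡3²ᵏ k)
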